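{- Let $s\ge 1$, $L\ge 2s^3+5s^2+1$, $L\le k\le s+L$ and $n\ge 2s^5+8s^4+s^3-14s^2+3s+1$ be integers, and write $k=rs+t$ with integers $r$ and $0\le t\le s-1$. There is an injection $\phi_5:C^5_{L,s,2}(n)\to F^5_{L,s,k}(n)$.
   Context: $C_{L,s,2}(n)$ is the set of partitions of $n$ with all parts in $\{s+1,\ldots,s+L\}$; for such a partition, $f_i$ denotes the number of parts equal to $i$. $F_{L,s,k}(n)$ is the set of partitions of $n$ with smallest part equal to $s$, largest part at most $s+L$, and no part equal to $k$; for such a partition, $g_i$ denotes the number of parts equal to $i$. $C^5_{L,s,2}(n)$ is the set of partitions in $C_{L,s,2}(n)$ with $f_k=1$. $F^5_{L,s,k}(n)$ is the set of partitions in $F_{L,s,k}(n)$ with $g_s=r-4$ and $g_{2s}\ge 1$. -}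

module Defs where

open import Data.Nat using (ℕ; zero; suc; _+_; _*_; _∸_; _≤_; _<_; _≥_; _≟_)
open import Data.List using (List; []; _∷_)
open import Data.Nat.ListAction using (sum)
open import Data.List.Relation.Unary.All using (All)
open import Data.List.Relation.Unary.Linked using (Linked)
open import Data.List.Membership.Propositional using (_∈_)
open import Data.Product using (Σ; _×_; proj₁)
open import Relation.Nullary using (yes; no; ¬_)
open import Relation.Binary.PropositionalEquality using (_≡_)

IsPartition : ℕ → List ℕ → Set
IsPartition n xs = All (λ x → 1 ≤ x) xs × Linked _≥_ xs × sum xs ≡ n

mult : ℕ → List ℕ → ℕ
mult i [] = 0
mult i (x ∷ xs) with i ≟ x
... | yes _ = suc (mult i xs)
... | no  _ = mult i xs

InC : ℕ → ℕ → ℕ → List ℕ → Set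
InC L s n xs = IsPartition n xs × All (λ x → s + 1 ≤ x × x ≤ s + L) xs

InF : ℕ → ℕ → ℕ → ℕ → List ℕ → Set
InF L s k n xs =
  IsPartition n xs × (s ∈ xs × All (λ x → s ≤ x) xs) × All (λ x → x ≤ s + L) xs
  × All (λ x → ¬ (x ≡ k)) xs

C5 : ℕ → ℕ → ℕ → ℕ → Set
C5 L s k n = Σ (List ℕ) λ xs → InC L s n xs × mult k xs ≡ 1

F5 : ℕ → ℕ → ℕ → ℕ → ℕ → Set
F5 L s k r n = Σ (List ℕ) λ xs → InF L s k n xs × mult s xs ≡ r ∸ 4 × 1 ≤ mult (s + s) xs

-- The bound L ≥ 2s³+5s²+1 gives 5s < L ≤ k,
-- hence r ≥ 5, so that k splits as
--     k = 2s + (2s+t) + (r-4)·s .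
-- Given λ ∈ C⁵ (parts in [s+1, s+L], the part k occurring exactly once), φ₅
-- removes the part k and puts in its place the parts 2s, 2s+t and r-4 copies
-- of s.  The sum is unchanged, s becomes the smallest part with multiplicity
-- r-4, the part 2s occurs, all parts stay ≤ s+L and none equals k (2s+t < k,
-- and the removed k was the only one).  Each step is invertible, so φ₅ is
-- injective.
module Submission where

open import Defs
open import Data.Nat using (ℕ; zero; suc; _+_; _*_; _^_; _≤_; _<_; _≥_; _≟_; _≤?_; z≤n; s≤s)
open import Data.Nat.Properties
open import Data.Nat.ListAction using (sum)
open import Data.Nat.ListAction.Properties using (sum-++)
open import Data.Nat.Solver using (module +-*-Solver)
open import Data.List using (List; []; _∷_; _++_; replicate)
open import Data.List.Properties using (++-cancelʳ)
open import Data.List.Relation.Unary.All as All using (All; []; _∷_)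
open import Data.List.Relation.Unary.All.Properties using (++⁺; replicate⁺)
open import Data.List.Relation.Unary.AllPairs using (AllPairs; []; _∷_)
open import Data.List.Relation.Unary.Linked using (Linked)
open import Data.List.Relation.Unary.Linked.Properties using (AllPairs⇒Linked; Linked⇒AllPairs)
open import Data.List.Relation.Unary.Any using (here)
open import Data.List.Membership.Propositional using (_∈_)
open import Data.List.Membership.Propositional.Properties using (∈-++⁺ʳ)
open import Data.Product using (Σ; proj₁; proj₂; _,_; _×_)
open import Data.Empty using (⊥-elim)
open import Relation.Nullary using (yes; no; ¬_)
open import Relation.Binary.PropositionalEquality
  using (_≡_; refl; sym; trans; cong; cong₂; subst; module ≡-Reasoning)

-- A nonincreasing list, in the pairwise form that is convenient for insertion.
Sorted : List ℕ → Set
Sorted = AllPairs _≥_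

linked⇒sorted : ∀ {xs} → Linked _≥_ xs → Sorted xs
linked⇒sorted = Linked⇒AllPairs (λ p q → ≤-trans q p)

insert : ℕ → List ℕ → List ℕ
insert a [] = a ∷ []
insert a (y ∷ ys) with y ≤? a
... | yes _ = a ∷ y ∷ ys
... | no  _ = y ∷ insert a ys

delete : ℕ → List ℕ → List ℕ
delete k [] = []
delete k (x ∷ xs) with k ≟ x
... | yes _ = xs
... | no  _ = x ∷ delete k xs

All-insert : ∀ {P : ℕ → Set} a ys → P a → All P ys → All P (insert a ys)
All-insert a [] pa _ = pa ∷ []
All-insert a (y ∷ ys) pa (py ∷ pys) with y ≤? a
... | yes _ = pa ∷ py ∷ pys
... | no  _ = py ∷ All-insert a ys pa pys

All-delete : ∀ {P : ℕ → Set} k xs → All P xs → All P (delete k xs)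
All-delete k [] _ = []
All-delete k (x ∷ xs) (px ∷ pxs) with k ≟ x
... | yes _ = pxs
... | no  _ = px ∷ All-delete k xs pxs

insert-sorted : ∀ a ys → Sorted ys → Sorted (insert a ys)
insert-sorted a [] _ = [] ∷ []
insert-sorted a (y ∷ ys) (y≥ys ∷ ys↓) with y ≤? a
... | yes y≤a = (y≤a ∷ All.map (λ z≤y → ≤-trans z≤y y≤a) y≥ys) ∷ y≥ys ∷ ys↓
... | no  y≰a = All-insert a ys (<⇒≤ (≰⇒> y≰a)) y≥ys ∷ insert-sorted a ys ys↓

delete-sorted : ∀ k xs → Sorted xs → Sorted (delete k xs)
delete-sorted k [] _ = []
delete-sorted k (x ∷ xs) (x≥xs ∷ xs↓) with k ≟ x
... | yes _ = xs↓
... | no  _ = All-delete k xs x≥xs ∷ delete-sorted k xs xs↓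

sorted-++-replicate : ∀ s m ys → Sorted ys → All (s ≤_) ys → Sorted (ys ++ replicate m s)
sorted-++-replicate s m [] _ _ = constant m
  where
  constant : ∀ m → Sorted (replicate m s)
  constant zero    = []
  constant (suc m) = replicate⁺ m ≤-refl ∷ constant m
sorted-++-replicate s m (y ∷ ys) (y≥ys ∷ ys↓) (s≤y ∷ s≤ys) =
  ++⁺ y≥ys (replicate⁺ m s≤y) ∷ sorted-++-replicate s m ys ys↓ s≤ys

sum-insert : ∀ a ys → sum (insert a ys) ≡ a + sum ys
sum-insert a [] = refl
sum-insert a (y ∷ ys) with y ≤? a
... | yes _ = refl
... | no  _ = begin
  y + sum (insert a ys) ≡⟨ cong (y +_) (sum-insert a ys) ⟩
  y + (a + sum ys)      ≡⟨ +-comm-middle y a (sum ys) ⟩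
  a + (y + sum ys)      ∎
  where
  open ≡-Reasoning
  +-comm-middle : ∀ x y z → x + (y + z) ≡ y + (x + z)
  +-comm-middle x y z = trans (sym (+-assoc x y z)) (trans (cong (_+ z) (+-comm x y)) (+-assoc y x z))

sum-replicate : ∀ m s → sum (replicate m s) ≡ m * s
sum-replicate zero    s = refl
sum-replicate (suc m) s = cong (s +_) (sum-replicate m s)

mult-insert : ∀ a ys → mult a (insert a ys) ≡ suc (mult a ys)
mult-insert a [] with a ≟ a
... | yes _  = refl
... | no a≢a = ⊥-elim (a≢a refl)
mult-insert a (y ∷ ys) with y ≤? a
... | yes _ with a ≟ a
...   | yes _  = refl
...   | no a≢a = ⊥-elim (a≢a refl)
mult-insert a (y ∷ ys) | no _ with a ≟ y
... | yes _ = cong suc (mult-insert a ys)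
... | no  _ = mult-insert a ys

mult-++ : ∀ i xs ys → mult i (xs ++ ys) ≡ mult i xs + mult i ys
mult-++ i [] ys = refl
mult-++ i (x ∷ xs) ys with i ≟ x
... | yes _ = cong suc (mult-++ i xs ys)
... | no  _ = mult-++ i xs ys

mult-replicate : ∀ m s → mult s (replicate m s) ≡ m
mult-replicate zero    s = refl
mult-replicate (suc m) s with s ≟ s
... | yes _  = cong suc (mult-replicate m s)
... | no s≢s = ⊥-elim (s≢s refl)

mult-below : ∀ s xs → All (s <_) xs → mult s xs ≡ 0
mult-below s [] _ = refl
mult-below s (x ∷ xs) (s<x ∷ s<xs) with s ≟ x
... | yes refl = ⊥-elim (<-irrefl refl s<x)
... | no  _    = mult-below s xs s<xs

mult-zero : ∀ k xs → mult k xs ≡ 0 → All (λ x → ¬ (x ≡ k)) xs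
mult-zero k [] _ = []
mult-zero k (x ∷ xs) h with k ≟ x
... | yes _ with h
...   | ()
mult-zero k (x ∷ xs) h | no k≢x = (λ x≡k → k≢x (sym x≡k)) ∷ mult-zero k xs h

delete-unique : ∀ k xs → mult k xs ≡ 1 → All (λ x → ¬ (x ≡ k)) (delete k xs)
delete-unique k (x ∷ xs) h with k ≟ x
... | yes _   = mult-zero k xs (suc-injective h)
... | no  k≢x = (λ x≡k → k≢x (sym x≡k)) ∷ delete-unique k xs h

mult-All : ∀ {P : ℕ → Set} k xs → All P xs → 1 ≤ mult k xs → P k
mult-All k (x ∷ xs) (px ∷ pxs) h with k ≟ x
... | yes refl = px
... | no  _    = mult-All k xs pxs h

delete-insert : ∀ a ys → delete a (insert a ys) ≡ ys
delete-insert a [] with a ≟ a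
... | yes _  = refl
... | no a≢a = ⊥-elim (a≢a refl)
delete-insert a (y ∷ ys) with y ≤? a
... | yes _ with a ≟ a
...   | yes _  = refl
...   | no a≢a = ⊥-elim (a≢a refl)
delete-insert a (y ∷ ys) | no y≰a with a ≟ y
... | yes refl = ⊥-elim (y≰a ≤-refl)
... | no  _    = cong (y ∷_) (delete-insert a ys)

insert-delete : ∀ k xs → Sorted xs → 1 ≤ mult k xs → insert k (delete k xs) ≡ xs
insert-delete k (x ∷ xs) (x≥xs ∷ xs↓) h with k ≟ x
insert-delete k (x ∷ []) _ h | yes refl = refl
insert-delete k (x ∷ y ∷ xs) ((y≤x ∷ _) ∷ _) h | yes refl with y ≤? k
... | yes _   = refl
... | no  y≰k = ⊥-elim (y≰k y≤x)
insert-delete k (x ∷ xs) (x≥xs ∷ xs↓) h | no k≢x with x ≤? k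
... | yes x≤k = ⊥-elim (k≢x (≤-antisym (mult-All k xs x≥xs h) x≤k))
... | no  _   = cong (x ∷_) (insert-delete k xs xs↓ h)

insert-injective : ∀ a xs ys → insert a xs ≡ insert a ys → xs ≡ ys
insert-injective a xs ys eq = begin
  xs                      ≡⟨ sym (delete-insert a xs) ⟩
  delete a (insert a xs)  ≡⟨ cong (delete a) eq ⟩
  delete a (insert a ys)  ≡⟨ delete-insert a ys ⟩
  ys                      ∎
  where open ≡-Reasoning

delete-injective : ∀ k xs ys → Sorted xs → Sorted ys → 1 ≤ mult k xs → 1 ≤ mult k ys
  → delete k xs ≡ delete k ys → xs ≡ ys
delete-injective k xs ys xs↓ ys↓ kxs kys eq = begin
  xs                      ≡⟨ sym (insert-delete k xs xs↓ kxs) ⟩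
  insert k (delete k xs)  ≡⟨ cong (insert k) eq ⟩
  insert k (delete k ys)  ≡⟨ insert-delete k ys ys↓ kys ⟩
  ys                      ∎
  where open ≡-Reasoning

-- The hypothesis on L is only used through 5s < L.
five-s<L : ∀ s L → 2 * s ^ 3 + 5 * s ^ 2 + 1 ≤ L → 5 * s < L
five-s<L zero        L hL = hL
five-s<L s@(suc _)   L hL = begin-strict
  5 * s                     ≤⟨ *-monoʳ-≤ 5 (m≤m*n s (s ^ 1)) ⟩
  5 * s ^ 2                 ≤⟨ m≤n+m (5 * s ^ 2) (2 * s ^ 3) ⟩
  2 * s ^ 3 + 5 * s ^ 2     <⟨ m<m+n _ (s≤s z≤n) ⟩
  2 * s ^ 3 + 5 * s ^ 2 + 1 ≤⟨ hL ⟩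
  L                         ∎
  where open ≤-Reasoning

five≤quotient : ∀ s r t → t < s → 5 * s < r * s + t → 5 ≤ r
five≤quotient s r t t<s h = ≤-pred (*-cancelʳ-< s 5 (suc r) (begin-strict
  5 * s      <⟨ h ⟩
  r * s + t  <⟨ +-monoʳ-< (r * s) t<s ⟩
  r * s + s  ≡⟨ +-comm (r * s) s ⟩
  suc r * s  ∎))
  where open ≤-Reasoning

-- The replacement map, for a fixed decomposition k = (5 + r')·s + t with t < s.
module Replacement (s L k r' t : ℕ) (1≤s : 1 ≤ s) (2s≤L : s + s ≤ L)
                   (k≡ : k ≡ (5 + r') * s + t) (t<s : t < s) where

  -- the parts 2s and 2s + t that, with r' + 1 copies of s, replace k
  b a : ℕ
  b = s + s
  a = s + s + t

  k-split : k ≡ b + a + suc r' * s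
  k-split = trans k≡ (solve 3 (λ s t r → (con 5 :+ r) :* s :+ t
                                       := (s :+ s) :+ (s :+ s :+ t) :+ (con 1 :+ r) :* s)
                                refl s t r')
    where open +-*-Solver

  core : List ℕ → List ℕ
  core xs = insert b (insert a (delete k xs))

  -- φ₅ on the underlying list: the r' + 1 = r - 4 copies of s go at the end
  φ₅ : List ℕ → List ℕ
  φ₅ xs = core xs ++ replicate (suc r') s

  s<b : s < b
  s<b = m<m+n s 1≤s

  s<a : s < a
  s<a = <-≤-trans s<b (m≤m+n b t)

  a<k : a < k
  a<k = begin-strict
    a                   <⟨ m<n+m a (<-trans 1≤s s<b) ⟩
    b + a               ≤⟨ m≤m+n (b + a) _ ⟩
    b + a + suc r' * s  ≡⟨ sym k-split ⟩
    k                   ∎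
    where open ≤-Reasoning

  b<k : b < k
  b<k = ≤-<-trans (m≤m+n b t) a<k

  a≤s+L : a ≤ s + L
  a≤s+L = begin
    s + s + t   ≡⟨ +-assoc s s t ⟩
    s + (s + t) ≤⟨ +-monoʳ-≤ s (≤-trans (+-monoʳ-≤ s (<⇒≤ t<s)) 2s≤L) ⟩
    s + L       ∎
    where open ≤-Reasoning

  b≤s+L : b ≤ s + L
  b≤s+L = +-monoʳ-≤ s (≤-trans (m≤m+n s s) 2s≤L)

  core-bounded : ∀ xs → All (λ x → s + 1 ≤ x × x ≤ s + L) xs
    → All (λ x → s < x × x ≤ s + L) (core xs)
  core-bounded xs bounds =
    All-insert b _ (s<b , b≤s+L) (All-insert a _ (s<a , a≤s+L)
      (All-delete k xs (All.map (λ {x} (lo , hi) → subst (_≤ x) (+-comm s 1) lo , hi) bounds)))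

  -- k occurred exactly once and the new parts are smaller than k.
  core-avoids-k : ∀ xs → mult k xs ≡ 1 → All (λ x → ¬ (x ≡ k)) (core xs)
  core-avoids-k xs k-once =
    All-insert b _ (<⇒≢ b<k) (All-insert a _ (<⇒≢ a<k) (delete-unique k xs k-once))

  core-sorted : ∀ xs → Sorted xs → Sorted (core xs)
  core-sorted xs xs↓ = insert-sorted b _ (insert-sorted a _ (delete-sorted k xs xs↓))

  -- The replacement preserves the sum because k = 2s + (2s + t) + (r' + 1)·s.
  sum-φ₅ : ∀ xs → Sorted xs → 1 ≤ mult k xs → sum (φ₅ xs) ≡ sum xs
  sum-φ₅ xs xs↓ k∈xs = begin
    sum (core xs ++ replicate (suc r') s)   ≡⟨ sum-++ (core xs) (replicate (suc r') s) ⟩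
    sum (core xs) + sum (replicate (suc r') s)
      ≡⟨ cong₂ _+_ (trans (sum-insert b (insert a (delete k xs))) (cong (b +_) (sum-insert a (delete k xs)))) (sum-replicate (suc r') s) ⟩
    b + (a + rest) + suc r' * s             ≡⟨ solve 4 (λ b a d m → b :+ (a :+ d) :+ m := b :+ a :+ m :+ d) refl b a rest (suc r' * s) ⟩
    b + a + suc r' * s + rest               ≡⟨ cong (_+ rest) (sym k-split) ⟩
    k + rest                                ≡⟨ sym (sum-insert k (delete k xs)) ⟩
    sum (insert k (delete k xs))            ≡⟨ cong sum (insert-delete k xs xs↓ k∈xs) ⟩
    sum xs                                  ∎
    where
    open ≡-Reasoning
    open +-*-Solver
    rest : ℕ
    rest = sum (delete k xs)

  -- The only parts equal to s are the r' + 1 appended copies.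
  mult-s-φ₅ : ∀ xs → All (s <_) (core xs) → mult s (φ₅ xs) ≡ suc r'
  mult-s-φ₅ xs above = begin
    mult s (core xs ++ replicate (suc r') s)           ≡⟨ mult-++ s (core xs) (replicate (suc r') s) ⟩
    mult s (core xs) + mult s (replicate (suc r') s)   ≡⟨ cong₂ _+_ (mult-below s _ above) (mult-replicate (suc r') s) ⟩
    suc r'                                             ∎
    where open ≡-Reasoning

  2s∈φ₅ : ∀ xs → 1 ≤ mult (s + s) (φ₅ xs)
  2s∈φ₅ xs = begin
    1                                                  ≤⟨ s≤s z≤n ⟩
    suc (mult b (insert a (delete k xs)))              ≡⟨ sym (mult-insert b (insert a (delete k xs))) ⟩
    mult b (core xs)                                   ≤⟨ m≤m+n _ _ ⟩
    mult b (core xs) + mult b (replicate (suc r') s)   ≡⟨ sym (mult-++ b (core xs) (replicate (suc r') s)) ⟩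
    mult b (φ₅ xs)                                     ∎
    where open ≤-Reasoning

  -- Each stage (append, two insertions, deletion of k) can be undone.
  φ₅-injective : ∀ xs ys → Sorted xs → Sorted ys → 1 ≤ mult k xs → 1 ≤ mult k ys
    → φ₅ xs ≡ φ₅ ys → xs ≡ ys
  φ₅-injective xs ys xs↓ ys↓ k∈xs k∈ys eq =
    delete-injective k xs ys xs↓ ys↓ k∈xs k∈ys
      (insert-injective a _ _ (insert-injective b _ _ (++-cancelʳ (replicate (suc r') s) _ _ eq)))

  injection : ∀ n → Σ (C5 L s k n → F5 L s k (5 + r') n)
                      λ φ → ∀ x y → proj₁ (φ x) ≡ proj₁ (φ y) → proj₁ x ≡ proj₁ y
  injection n = map , λ (xs , (((_ , xs↓ , _) , _) , k-once)) (ys , (((_ , ys↓ , _) , _) , k-once′)) →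
    φ₅-injective xs ys (linked⇒sorted xs↓) (linked⇒sorted ys↓)
                 (≤-reflexive (sym k-once)) (≤-reflexive (sym k-once′))
    where
    map : C5 L s k n → F5 L s k (5 + r') n
    map (xs , (((_ , linked , sum≡n) , bounds) , k-once)) =
      φ₅ xs , ((partition , (s∈φ₅ , s≤φ₅) , ≤s+L , avoids-k) , mult-s-φ₅ xs s<core , 2s∈φ₅ xs)
      where
      xs↓ : Sorted xs
      xs↓ = linked⇒sorted linked
      bounded : All (λ x → s < x × x ≤ s + L) (core xs)
      bounded = core-bounded xs bounds
      s<core : All (s <_) (core xs)
      s<core = All.map proj₁ bounded
      s≤φ₅ : All (s ≤_) (φ₅ xs)
      s≤φ₅ = ++⁺ (All.map <⇒≤ s<core) (replicate⁺ (suc r') ≤-refl)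
      s∈φ₅ : s ∈ φ₅ xs
      s∈φ₅ = ∈-++⁺ʳ (core xs) (here refl)
      ≤s+L : All (_≤ s + L) (φ₅ xs)
      ≤s+L = ++⁺ (All.map proj₂ bounded) (replicate⁺ (suc r') (m≤m+n s L))
      avoids-k : All (λ x → ¬ (x ≡ k)) (φ₅ xs)
      avoids-k = ++⁺ (core-avoids-k xs k-once) (replicate⁺ (suc r') (<⇒≢ (<-trans s<a a<k)))
      partition : IsPartition n (φ₅ xs)
      partition =
        All.map (≤-trans 1≤s) s≤φ₅ ,
        AllPairs⇒Linked (sorted-++-replicate s (suc r') (core xs) (core-sorted xs xs↓) (All.map <⇒≤ s<core)) ,
        trans (sum-φ₅ xs xs↓ (≤-reflexive (sym k-once))) sum≡n

lemma2p7 : (s L k n r t : ℕ) → 1 ≤ s → 2 * s ^ 3 + 5 * s ^ 2 + 1 ≤ L → L ≤ k → k ≤ s + L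
    → 2 * s ^ 5 + 8 * s ^ 4 + s ^ 3 + 3 * s + 1 ≤ n + 14 * s ^ 2
    → k ≡ r * s + t → t < s
    → Σ (C5 L s k n → F5 L s k r n) λ φ → ∀ x y → proj₁ (φ x) ≡ proj₁ (φ y) → proj₁ x ≡ proj₁ y
lemma2p7 s L k n r t 1≤s hL L≤k _ _ k≡ t<s
  with m≤n⇒∃[o]m+o≡n (five≤quotient s r t t<s (subst (5 * s <_) k≡ (<-≤-trans (five-s<L s L hL) L≤k)))
... | r' , refl = Replacement.injection s L k r' t 1≤s 2s≤L k≡ t<s n
  where
  -- 2s ≤ 5s < L
  2s≤L : s + s ≤ L
  2s≤L = ≤-trans (+-monoʳ-≤ s (m≤m+n s (3 * s))) (<⇒≤ (five-s<L s L hL))
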